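{- Let $K\subseteq\Delta$ contain a set of $\ell$ consecutive simple roots $\{\alpha_j,\alpha_{j+1},\dots,\alpha_{j+\ell-1}\}$. Let $\mu=(\mu_1,\dots,\mu_k)$ be a partition of $n$ with $k$ parts. If $\ell+1>k$, then \[ \mathcal{D}(\Delta\setminus K,J_\mu)=\{w\in\mathfrak{S}_n:\mathrm{Des}_L(w)=K,\ \mathrm{Des}_R(w)\subseteq\Delta\setminus J_\mu\}=\emptyset. \]
   Context: $\Delta=\{\alpha_1,\dots,\alpha_{n-1}\}$ (simple roots of $\mathfrak{gl}(n,\mathbb{C})$). For $w\in\mathfrak{S}_n$: $\mathrm{Des}_L(w)=\{\alpha_i:w^{ -1}(i)>w^{ -1}(i+1)\}$, $\mathrm{Des}_R(w)=\{\alpha_i:w(i)>w(i+1)\}$. $\mathcal{D}(J,K')=\{w\in\mathfrak{S}_n:\mathrm{Des}_L(w)=\Delta\setminus J,\ \mathrm{Des}_R(w)\subseteq\Delta\setminus K'\}$. $J_\mu=\Delta\setminus\{\alpha_{\mu_1},\alpha_{\mu_1+\mu_2},\dots,\alpha_{\mu_1+\cdots+\mu_{k-1}}\}$. -}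

module Defs where

open import Data.Nat using (ℕ; zero; suc; _+_; _≤_; _≥_)
open import Data.Fin using (Fin; toℕ; inject₁) renaming (_<_ to _<ᶠ_)
open import Data.Fin.Subset using (Subset; _∈_; ∁)
open import Data.Fin.Permutation using (Permutation′; _⟨$⟩ʳ_; _⟨$⟩ˡ_)
open import Data.List using (List; []; _∷_; map; length)
open import Data.Nat.ListAction using (sum)
open import Data.List.Relation.Unary.All using (All)
open import Data.List.Relation.Unary.Any using (any?)
open import Data.List.Relation.Unary.AllPairs using (AllPairs)
open import Data.Vec using (tabulate)
open import Data.Bool using (not)
open import Data.Product using (_×_)
open import Function.Bundles using (_⇔_)
open import Relation.Nullary.Decidable using (⌊_⌋)
open import Relation.Binary.PropositionalEquality using (_≡_)
import Data.Nat as ℕ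

-- Convention: n = suc m, 𝔖ₙ = Permutation′ (suc m) acting on positions
-- Fin (suc m) = {0,…,m} (0-indexed version of {1,…,n}).
-- Simple roots Δ = {α₁,…,α_{n-1}} are indexed by r : Fin m, with
-- r ↔ α_{toℕ r + 1}; α_i compares positions i and i+1 (1-indexed),
-- i.e. inject₁ r and suc r (0-indexed).  Subsets of Δ are Subset m.

DesR : ∀ {m} → Permutation′ (suc m) → Fin m → Set
DesR w r = (w ⟨$⟩ʳ Fin.suc r) <ᶠ (w ⟨$⟩ʳ inject₁ r)
  where import Data.Fin as Fin

DesL : ∀ {m} → Permutation′ (suc m) → Fin m → Set
DesL w r = (w ⟨$⟩ˡ Fin.suc r) <ᶠ (w ⟨$⟩ˡ inject₁ r)
  where import Data.Fin as Fin

𝒟 : ∀ {m} → Subset m → Subset m → Permutation′ (suc m) → Set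
𝒟 J K′ w = (∀ r → DesL w r ⇔ r ∈ ∁ J) × (∀ r → DesR w r → r ∈ ∁ K′)

IsPartition : ℕ → List ℕ → Set
IsPartition n μ = All (1 ≤_) μ × AllPairs _≥_ μ × sum μ ≡ n

cuts : List ℕ → List ℕ
cuts [] = []
cuts (x ∷ []) = []
cuts (x ∷ y ∷ rest) = x ∷ map (x +_) (cuts (y ∷ rest))

J[_] : ∀ {m} → List ℕ → Subset m
J[ μ ] = tabulate λ r → not ⌊ any? (λ c → suc (toℕ r) ℕ.≟ c) (cuts μ) ⌋

module Submission where

open import Defs
open import Data.Nat using (ℕ; suc; _+_; _≤_; _<_)
open import Data.Fin using (Fin; toℕ)
open import Data.Fin.Subset using (Subset; _∈_; ∁)
open import Data.Fin.Permutation using (Permutation′)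
open import Data.List using (List; length)
open import Relation.Nullary using (¬_)

open import Data.Nat using (zero; z≤n; s≤s; s≤s⁻¹; _∸_; pred; _≤?_; _≟_)
open import Data.Nat.Properties
open import Data.Fin as F using (inject₁; fromℕ<)
open import Data.Fin.Properties using (toℕ-injective; toℕ-inject₁; toℕ-fromℕ<)
open import Data.Fin.Subset.Properties using (x∈p⇒x∉∁p; x∉p⇒x∈∁p; x∈∁p⇒x∉p)
open import Data.Fin.Permutation using (_⟨$⟩ʳ_; _⟨$⟩ˡ_; inverseʳ)
open import Data.List using ([]; _∷_)
open import Data.List.Properties using (length-map)
open import Data.List.Relation.Unary.Any using (Any; here; there; any?)
open import Data.Vec using (lookup)
open import Data.Vec.Properties using (lookup∘tabulate; lookup⇒[]=)
open import Data.Bool using (true; not)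
open import Data.Product using (_,_)
open import Function.Bundles using (Equivalence)
open import Relation.Nullary.Decidable using (⌊_⌋; yes; no)
open import Relation.Nullary using (contradiction)
open import Relation.Binary.PropositionalEquality

-- Cut the positions 0,…,m into the consecutive blocks of μ and
-- let block(p) be the index of the block containing position p, i.e. the
-- number of cuts μ₁, μ₁+μ₂, … that are ≤ p.  If Des_R(w) ⊆ Δ∖J_μ, every
-- right descent of w crosses a block boundary, so w is increasing on each
-- block.  Consequently, whenever α_r is a left descent (w⁻¹(r+1) < w⁻¹(r)),
-- the positions w⁻¹(r+1), w⁻¹(r) lie in different blocks, and in fact
--   block(w⁻¹(r+1)) < block(w⁻¹(r)).
-- If Des_L(w) = K ⊇ {α_j,…,α_{j+ℓ-1}}, the function v ↦ block(w⁻¹(v))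
-- strictly decreases along the ℓ steps j-1 → j → … → j+ℓ-1, so its value at
-- j-1 is at least ℓ.  But a block index is at most the number of cuts,
-- which is k-1 < ℓ: contradiction.

blockOf : List ℕ → ℕ → ℕ
blockOf [] x = 0
blockOf (c ∷ cs) x with c ≤? x
... | yes _ = suc (blockOf cs x)
... | no _ = blockOf cs x

blockOf-mono : ∀ cs {x y} → x ≤ y → blockOf cs x ≤ blockOf cs y
blockOf-mono [] x≤y = z≤n
blockOf-mono (c ∷ cs) {x} {y} x≤y with c ≤? x | c ≤? y
... | yes _   | yes _   = s≤s (blockOf-mono cs x≤y)
... | yes c≤x | no c≰y  = contradiction (≤-trans c≤x x≤y) c≰y
... | no _    | yes _   = m≤n⇒m≤1+n (blockOf-mono cs x≤y)
... | no _    | no _    = blockOf-mono cs x≤y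

blockOf-cut : ∀ cs x → Any (suc x ≡_) cs → blockOf cs x < blockOf cs (suc x)
blockOf-cut (c ∷ cs) x (here refl) with c ≤? x | c ≤? suc x
... | yes sx≤x | _        = contradiction sx≤x (n≮n x)
... | no _     | yes _    = s≤s (blockOf-mono cs (n≤1+n x))
... | no _     | no sx≰sx = contradiction ≤-refl sx≰sx
blockOf-cut (c ∷ cs) x (there cut) with c ≤? x | c ≤? suc x
... | yes _   | yes _    = s≤s (blockOf-cut cs x cut)
... | yes c≤x | no c≰sx  = contradiction (m≤n⇒m≤1+n c≤x) c≰sx
... | no _    | yes _    = m≤n⇒m≤1+n (blockOf-cut cs x cut)
... | no _    | no _     = blockOf-cut cs x cut

blockOf-≤-length : ∀ cs x → blockOf cs x ≤ length cs
blockOf-≤-length [] x = z≤n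
blockOf-≤-length (c ∷ cs) x with c ≤? x
... | yes _ = s≤s (blockOf-≤-length cs x)
... | no _  = m≤n⇒m≤1+n (blockOf-≤-length cs x)

length-cuts : ∀ μ → length (cuts μ) ≤ pred (length μ)
length-cuts [] = z≤n
length-cuts (x ∷ []) = z≤n
length-cuts (x ∷ y ∷ rest) =
  s≤s (subst (_≤ length rest) (sym (length-map (x +_) (cuts (y ∷ rest))))
             (length-cuts (y ∷ rest)))

∉J⇒cut : ∀ {m} (μ : List ℕ) (r : Fin m) → r ∈ ∁ (J[_] {m} μ) → Any (suc (toℕ r) ≡_) (cuts μ)
∉J⇒cut {m} μ r r∈∁J with any? (λ c → suc (toℕ r) ≟ c) (cuts μ) in eq
... | yes cut = cut
... | no _ = contradiction (lookup⇒[]= r (J[_] {m} μ) r∈J) (x∈∁p⇒x∉p r∈∁J)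
  where
    r∈J : lookup (J[_] {m} μ) r ≡ true
    r∈J = trans (lookup∘tabulate _ r) (cong (λ d → not ⌊ d ⌋) eq)

module WithinBlocks {m : ℕ} (g : Fin (suc m) → ℕ) (C : ℕ → ℕ)
         (C-mono : ∀ {x y} → x ≤ y → C x ≤ C y)
         (descent⇒boundary : ∀ (r : Fin m) → g (F.suc r) < g (inject₁ r) → C (toℕ r) < C (suc (toℕ r)))
         where

  increasing-at-distance : ∀ d (a b : Fin (suc m)) → toℕ a + d ≡ toℕ b
                         → C (toℕ b) ≤ C (toℕ a) → g a ≤ g b
  increasing-at-distance zero a b a≡b _ =
    ≤-reflexive (cong g (toℕ-injective (trans (sym (+-identityʳ (toℕ a))) a≡b)))
  increasing-at-distance (suc d) a F.zero a+d≡0 _ =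
    contradiction (trans (sym (+-suc (toℕ a) d)) a+d≡0) λ ()
  increasing-at-distance (suc d) a (F.suc r) a+d≡r+1 Cr+1≤Ca =
    ≤-trans g[a]≤g[r] g[r]≤g[r+1]
    where
      a+d≡r : toℕ a + d ≡ toℕ r
      a+d≡r = suc-injective (trans (sym (+-suc (toℕ a) d)) a+d≡r+1)
      Cr≤Ca : C (toℕ r) ≤ C (toℕ a)
      Cr≤Ca = ≤-trans (C-mono (n≤1+n (toℕ r))) Cr+1≤Ca
      g[a]≤g[r] : g a ≤ g (inject₁ r)
      g[a]≤g[r] = increasing-at-distance d a (inject₁ r)
                    (trans a+d≡r (sym (toℕ-inject₁ r)))
                    (subst (λ i → C i ≤ C (toℕ a)) (sym (toℕ-inject₁ r)) Cr≤Ca)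
      -- a descent at r would put r+1 in a later block than a ≤ r
      g[r]≤g[r+1] : g (inject₁ r) ≤ g (F.suc r)
      g[r]≤g[r+1] = ≮⇒≥ λ desc →
        <⇒≱ (descent⇒boundary r desc)
            (≤-trans Cr+1≤Ca (C-mono (subst (toℕ a ≤_) a+d≡r (m≤m+n (toℕ a) d))))

  increasing-within-block : ∀ (a b : Fin (suc m)) → toℕ a ≤ toℕ b
                          → C (toℕ b) ≤ C (toℕ a) → g a ≤ g b
  increasing-within-block a b a≤b =
    increasing-at-distance (toℕ b ∸ toℕ a) a b (m+[n∸m]≡n a≤b)

left-descent⇒block-drop :
  ∀ {m} (w : Permutation′ (suc m)) (C : ℕ → ℕ) → (∀ {x y} → x ≤ y → C x ≤ C y)
  → (∀ (r : Fin m) → DesR w r → C (toℕ r) < C (suc (toℕ r)))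
  → ∀ (r : Fin m) → DesL w r
  → C (toℕ (w ⟨$⟩ˡ F.suc r)) < C (toℕ (w ⟨$⟩ˡ inject₁ r))
left-descent⇒block-drop w C C-mono rightDes⇒boundary r leftDes = ≰⇒> λ sameBlock →
  1+n≰n (subst (suc (toℕ r) ≤_) (toℕ-inject₁ r)
          (subst₂ _≤_ (cong toℕ (inverseʳ w)) (cong toℕ (inverseʳ w))
            (increasing-within-block (w ⟨$⟩ˡ F.suc r) (w ⟨$⟩ˡ inject₁ r) (<⇒≤ leftDes) sameBlock)))
  where
    open WithinBlocks (λ x → toℕ (w ⟨$⟩ʳ x)) C C-mono rightDes⇒boundary

descending-run-height :
  ∀ {m} (h : Fin (suc m) → ℕ) d (v : Fin (suc m)) → toℕ v + d ≤ m
  → (∀ (r : Fin m) → toℕ v ≤ toℕ r → toℕ r < toℕ v + d → h (F.suc r) < h (inject₁ r))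
  → d ≤ h v
descending-run-height h zero v _ _ = z≤n
descending-run-height {m} h (suc d) v v+d≤m drops =
  subst (λ u → suc d ≤ h u) inject₁r≡v
    (≤-trans (s≤s (descending-run-height h d (F.suc r) r+1+d≤m drops′))
             (drops r (≤-reflexive (sym toℕr≡v)) (subst (_< toℕ v + suc d) (sym toℕr≡v) v<v+d)))
  where
    v+1+d≡v+[1+d] : suc (toℕ v) + d ≡ toℕ v + suc d
    v+1+d≡v+[1+d] = sym (+-suc (toℕ v) d)
    v<m : toℕ v < m
    v<m = m+n≤o⇒m≤o (suc (toℕ v)) (subst (_≤ m) (sym v+1+d≡v+[1+d]) v+d≤m)
    r : Fin m
    r = fromℕ< v<m
    toℕr≡v : toℕ r ≡ toℕ v
    toℕr≡v = toℕ-fromℕ< v<m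
    inject₁r≡v : inject₁ r ≡ v
    inject₁r≡v = toℕ-injective (trans (toℕ-inject₁ r) toℕr≡v)
    v<v+d : toℕ v < toℕ v + suc d
    v<v+d = subst (toℕ v <_) v+1+d≡v+[1+d] (m≤m+n (suc (toℕ v)) d)
    r+1+d≤m : suc (toℕ r) + d ≤ m
    r+1+d≤m = subst (_≤ m) (sym (trans (cong (λ i → suc i + d) toℕr≡v) v+1+d≡v+[1+d])) v+d≤m
    drops′ : ∀ (r′ : Fin m) → suc (toℕ r) ≤ toℕ r′ → toℕ r′ < suc (toℕ r) + d
           → h (F.suc r′) < h (inject₁ r′)
    drops′ r′ r<r′ r′<end =
      drops r′ (≤-trans (n≤1+n (toℕ v)) (subst (λ i → suc i ≤ toℕ r′) toℕr≡v r<r′))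
               (subst (toℕ r′ <_) (trans (cong (λ i → suc i + d) toℕr≡v) v+1+d≡v+[1+d]) r′<end)

corollary4p11 : (m : ℕ) (K : Subset m) (j ℓ : ℕ) → 1 ≤ j → 1 ≤ ℓ → j + ℓ ≤ suc m
    → (∀ (r : Fin m) → j ≤ suc (toℕ r) → suc (toℕ r) < j + ℓ → r ∈ K)
    → (μ : List ℕ) → IsPartition (suc m) μ → length μ < ℓ + 1
    → ∀ (w : Permutation′ (suc m)) → ¬ 𝒟 (∁ K) J[ μ ] w
corollary4p11 m K (suc i) (suc l) _ _ (s≤s i+ℓ≤m) run⊆K μ _ k<ℓ+1 w (desL⇔K , desR⊆cuts) =
  <⇒≱ height<ℓ height≥ℓ
  where
    C : ℕ → ℕ
    C = blockOf (cuts μ)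
    height : Fin (suc m) → ℕ
    height v = C (toℕ (w ⟨$⟩ˡ v))
    -- position j-1 (0-indexed), where the run α_j,…,α_{j+ℓ-1} starts
    start : Fin (suc m)
    start = fromℕ< (s≤s (m+n≤o⇒m≤o i i+ℓ≤m))
    start≡i : toℕ start ≡ i
    start≡i = toℕ-fromℕ< _
    rightDes⇒boundary : ∀ r → DesR w r → C (toℕ r) < C (suc (toℕ r))
    rightDes⇒boundary r des = blockOf-cut (cuts μ) (toℕ r) (∉J⇒cut μ r (desR⊆cuts r des))
    K⇒leftDes : ∀ r → r ∈ K → DesL w r
    K⇒leftDes r r∈K = Equivalence.from (desL⇔K r) (x∉p⇒x∈∁p (x∈p⇒x∉∁p r∈K))
    run⇒drop : ∀ r → toℕ start ≤ toℕ r → toℕ r < toℕ start + suc l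
             → height (F.suc r) < height (inject₁ r)
    run⇒drop r start≤r r<end =
      left-descent⇒block-drop w C (blockOf-mono (cuts μ)) rightDes⇒boundary r
        (K⇒leftDes r (run⊆K r (s≤s (subst (_≤ toℕ r) start≡i start≤r))
                              (s≤s (subst (λ s → toℕ r < s + suc l) start≡i r<end))))
    height≥ℓ : suc l ≤ height start
    height≥ℓ = descending-run-height height (suc l) start
                 (subst (λ s → s + suc l ≤ m) (sym start≡i) i+ℓ≤m) run⇒drop
    -- block indices are bounded by the number of cuts, at most k-1 < ℓ
    height<ℓ : height start < suc l
    height<ℓ = ≤-<-trans (blockOf-≤-length (cuts μ) _)
                 (≤-<-trans (length-cuts μ)
                   (s≤s (pred-mono-≤ (s≤s⁻¹ (subst (length μ <_) (+-comm (suc l) 1) k<ℓ+1)))))
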